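{- If $(K,\le,\wedge,\vee,0,1,{}^\circ)$ is a complete quasiintuitionistic algebra, then $(K_{\circ\circ},\le,\wedge,\curlyvee,0,1,{}^\circ)$ is a complete lattice, where $K_{\circ\circ}:=\{x^{\circ\circ}\mid x\in K\}$ carries the restricted order and ${}^\circ$, the meet is the restriction of $\wedge$, and the join is $\alpha\curlyvee\beta:=(\alpha\vee\beta)^{\circ\circ}$.
   Context: A quasiintuitionistic algebra is a bounded distributive lattice $(K,\le,\wedge,\vee,0,1)$ with a map ${}^\circ:K\to K$ such that for all $x,y\in K$: $x\le y$ implies $y^\circ\le x^\circ$; $x\le x^{\circ\circ}$; $x\wedge x^\circ\le y$. It is complete if the underlying lattice is complete. -}

module Defs where

open import Level using (Level; _⊔_; suc)
open import Data.Product using (Σ; ∃; _×_; _,_)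
open import Relation.Unary using (Pred; _∈_; _⊆_)
open import Relation.Binary.Core using (Rel)
open import Algebra.Core using (Op₁; Op₂)
open import Algebra.Definitions using (_DistributesOverˡ_)
open import Relation.Binary.Lattice.Structures using (IsBoundedLattice)

record QuasiIntuitionisticAlgebra c ℓ₁ ℓ₂ : Set (suc (c ⊔ ℓ₁ ⊔ ℓ₂)) where
  infix  4 _≈_ _≤_
  infixr 6 _∨_
  infixr 7 _∧_
  infix  9 _°
  field
    Carrier          : Set c
    _≈_              : Rel Carrier ℓ₁
    _≤_              : Rel Carrier ℓ₂
    _∨_              : Op₂ Carrier
    _∧_              : Op₂ Carrier
    ⊤                : Carrier
    ⊥                : Carrier
    isBoundedLattice : IsBoundedLattice _≈_ _≤_ _∨_ _∧_ ⊤ ⊥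
    ∧-distribˡ-∨     : _DistributesOverˡ_ _≈_ _∧_ _∨_
    _°               : Op₁ Carrier
    °-antitone       : ∀ {x y} → x ≤ y → y ° ≤ x °
    ≤-°°             : ∀ x → x ≤ (x °) °
    ∧-°-≤            : ∀ x y → x ∧ x ° ≤ y

  open IsBoundedLattice isBoundedLattice public

module _ {c ℓ₁ ℓ₂ : Level} (K : QuasiIntuitionisticAlgebra c ℓ₁ ℓ₂) where
  open QuasiIntuitionisticAlgebra K

  IsSup : ∀ {p} → Pred Carrier p → Carrier → Set (c ⊔ ℓ₂ ⊔ p)
  IsSup S s = (∀ x → x ∈ S → x ≤ s) × (∀ u → (∀ x → x ∈ S → x ≤ u) → s ≤ u)

  IsInf : ∀ {p} → Pred Carrier p → Carrier → Set (c ⊔ ℓ₂ ⊔ p)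
  IsInf S i = (∀ x → x ∈ S → i ≤ x) × (∀ u → (∀ x → x ∈ S → u ≤ x) → u ≤ i)

  IsComplete : (p : Level) → Set (c ⊔ ℓ₂ ⊔ suc p)
  IsComplete p = (S : Pred Carrier p) → (∃ λ s → IsSup S s) × (∃ λ i → IsInf S i)

  K°° : Pred Carrier (c ⊔ ℓ₁)
  K°° a = ∃ λ x → a ≈ (x °) °

  _⋎_ : Op₂ Carrier
  α ⋎ β = ((α ∨ β) °) °

  IsSupIn : ∀ {q p} → Pred Carrier q → Pred Carrier p → Carrier → Set (c ⊔ ℓ₂ ⊔ q ⊔ p)
  IsSupIn P S s = s ∈ P × (∀ x → x ∈ S → x ≤ s)
                        × (∀ u → u ∈ P → (∀ x → x ∈ S → x ≤ u) → s ≤ u)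

  IsInfIn : ∀ {q p} → Pred Carrier q → Pred Carrier p → Carrier → Set (c ⊔ ℓ₂ ⊔ q ⊔ p)
  IsInfIn P S i = i ∈ P × (∀ x → x ∈ S → i ≤ x)
                        × (∀ u → u ∈ P → (∀ x → x ∈ S → u ≤ x) → u ≤ i)

  record IsCompleteLatticeOn {q} (P : Pred Carrier q) (meet join : Op₂ Carrier)
           (bot top : Carrier) (p : Level) : Set (c ⊔ ℓ₂ ⊔ q ⊔ suc p) where
    field
      meet-closed : ∀ {a b} → a ∈ P → b ∈ P → meet a b ∈ P
      join-closed : ∀ {a b} → a ∈ P → b ∈ P → join a b ∈ P
      bot-closed  : bot ∈ P
      top-closed  : top ∈ P
      meet-inf    : ∀ {a b} → a ∈ P → b ∈ P →
                    meet a b ≤ a × meet a b ≤ b ×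
                    (∀ u → u ∈ P → u ≤ a → u ≤ b → u ≤ meet a b)
      join-sup    : ∀ {a b} → a ∈ P → b ∈ P →
                    a ≤ join a b × b ≤ join a b ×
                    (∀ u → u ∈ P → a ≤ u → b ≤ u → join a b ≤ u)
      bot-least   : ∀ {a} → a ∈ P → bot ≤ a
      top-greatest : ∀ {a} → a ∈ P → a ≤ top
      sups        : (S : Pred Carrier p) → S ⊆ P → ∃ λ s → IsSupIn P S s
      infs        : (S : Pred Carrier p) → S ⊆ P → ∃ λ i → IsInfIn P S i

-- The map x ↦ x°° is a closure operator (monotone, inflationary, idempotent),
-- and K°° is exactly its set of fixed points.  The fixed points of a closure
-- operator on a complete lattice are closed under arbitrary infima, so they
-- form a complete lattice whose meets are those of K and whose joins are the
-- closures of the joins in K.  Finally ⊥ = ⊤°°° because ⊤° ≤ ⊤ ∧ ⊤° ≤ ⊥.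
module Submission where

open import Defs
open import Level using (Level)
open import Data.Product using (_×_; _,_; proj₁; proj₂)
open import Relation.Unary using (Pred; _∈_; _⊆_)

module QuasiIntuitionisticAlgebraProperties
         {c ℓ₁ ℓ₂ : Level} (K : QuasiIntuitionisticAlgebra c ℓ₁ ℓ₂) where
  open QuasiIntuitionisticAlgebra K

  infixr 5 _⟫_
  _⟫_ : ∀ {x y z} → x ≤ y → y ≤ z → x ≤ z
  _⟫_ = trans

  °-cong : ∀ {x y} → x ≈ y → x ° ≈ y °
  °-cong x≈y = antisym (°-antitone (reflexive (Eq.sym x≈y))) (°-antitone (reflexive x≈y))

  °°-monotone : ∀ {x y} → x ≤ y → x ° ° ≤ y ° °
  °°-monotone x≤y = °-antitone (°-antitone x≤y)

  °°°≤° : ∀ x → x ° ° ° ≤ x °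
  °°°≤° x = °-antitone (≤-°° x)

  ⊤°≤⊥ : ⊤ ° ≤ ⊥
  ⊤°≤⊥ = ∧-greatest (maximum (⊤ °)) refl ⟫ ∧-°-≤ ⊤ ⊥

  °°≤⇒∈K°° : ∀ {a} → a ° ° ≤ a → a ∈ K°° K
  °°≤⇒∈K°° {a} a°°≤a = a , antisym (≤-°° a) a°°≤a

  ∈K°°⇒°°≤ : ∀ {a} → a ∈ K°° K → a ° ° ≤ a
  ∈K°°⇒°°≤ {a} (x , a≈x°°) =
    °°-monotone (reflexive a≈x°°) ⟫ °°°≤° (x °) ⟫ reflexive (Eq.sym a≈x°°)

  °°-least : ∀ {x a} → a ∈ K°° K → x ≤ a → x ° ° ≤ a
  °°-least a∈K°° x≤a = °°-monotone x≤a ⟫ ∈K°°⇒°°≤ a∈K°°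

  °°∈K°° : ∀ x → x ° ° ∈ K°° K
  °°∈K°° x = x , Eq.refl

  °-closed : ∀ {a} → a ∈ K°° K → a ° ∈ K°° K
  °-closed (x , a≈x°°) = x ° , °-cong a≈x°°

  ⊤∈K°° : ⊤ ∈ K°° K
  ⊤∈K°° = °°≤⇒∈K°° (maximum _)

  ⊥∈K°° : ⊥ ∈ K°° K
  ⊥∈K°° = ⊤ ° , antisym (minimum _) (°°°≤° ⊤ ⟫ ⊤°≤⊥)

  ∧-closed : ∀ {a b} → a ∈ K°° K → b ∈ K°° K → a ∧ b ∈ K°° K
  ∧-closed {a} {b} a∈K°° b∈K°° = °°≤⇒∈K°° (∧-greatest
    (°°-least a∈K°° (x∧y≤x a b))
    (°°-least b∈K°° (x∧y≤y a b)))

  isSup⇒isSupIn-K°° : ∀ {q} {S : Pred Carrier q} {s} →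
                      IsSup K S s → IsSupIn K (K°° K) S (s ° °)
  isSup⇒isSupIn-K°° {s = s} (upper , least) =
    °°∈K°° s ,
    (λ x x∈S → upper x x∈S ⟫ ≤-°° s) ,
    λ u u∈K°° S≤u → °°-least u∈K°° (least u S≤u)

  isInf⇒isInfIn-K°° : ∀ {q} {S : Pred Carrier q} {i} →
                      S ⊆ K°° K → IsInf K S i → IsInfIn K (K°° K) S i
  isInf⇒isInfIn-K°° {i = i} S⊆K°° (lower , greatest) =
    °°≤⇒∈K°° (greatest (i ° °) λ x x∈S → °°-least (S⊆K°° x∈S) (lower x x∈S)) ,
    lower ,
    λ u _ u≤S → greatest u u≤S

  K°°-isCompleteLattice : ∀ {p} → IsComplete K p →
                          IsCompleteLatticeOn K (K°° K) _∧_ (_⋎_ K) ⊥ ⊤ p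
  K°°-isCompleteLattice complete = record
    { meet-closed  = ∧-closed
    ; join-closed  = λ {a} {b} _ _ → °°∈K°° (a ∨ b)
    ; bot-closed   = ⊥∈K°°
    ; top-closed   = ⊤∈K°°
    ; meet-inf     = λ {a} {b} _ _ → x∧y≤x a b , x∧y≤y a b , λ _ _ → ∧-greatest
    ; join-sup     = λ {a} {b} _ _ →
        x≤x∨y a b ⟫ ≤-°° _ , y≤x∨y a b ⟫ ≤-°° _ ,
        λ _ u∈K°° a≤u b≤u → °°-least u∈K°° (∨-least a≤u b≤u)
    ; bot-least    = λ _ → minimum _
    ; top-greatest = λ _ → maximum _
    ; sups         = λ S _ → let s , s-sup = proj₁ (complete S) in
                       s ° ° , isSup⇒isSupIn-K°° s-sup
    ; infs         = λ S S⊆K°° → let i , i-inf = proj₂ (complete S) in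
                       i , isInf⇒isInfIn-K°° S⊆K°° i-inf
    }

mainTheorem5 : ∀ {c ℓ₁ ℓ₂} (p : Level) (K : QuasiIntuitionisticAlgebra c ℓ₁ ℓ₂) →
    IsComplete K p →
    IsCompleteLatticeOn K (K°° K) (QuasiIntuitionisticAlgebra._∧_ K) (_⋎_ K)
      (QuasiIntuitionisticAlgebra.⊥ K) (QuasiIntuitionisticAlgebra.⊤ K) p
    × (∀ {a} → a ∈ K°° K → QuasiIntuitionisticAlgebra._° K a ∈ K°° K)
mainTheorem5 p K complete = K°°-isCompleteLattice complete , °-closed
  where open QuasiIntuitionisticAlgebraProperties K
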